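{- For all integers $q,n\ge 2$, $\chi(q,n)=f(q,n)$.
   Context: An ordered graph is a graph on a linearly ordered vertex set. A monotone path of length $n$ in an ordered graph is a sequence of vertices $v_1<\dots<v_n$ with $v_iv_{i+1}$ an edge for each $i$. An ordered graph $G$ is $(q,n)$-path Ramsey if every coloring of its edges with $q$ colors contains a monotone path of length $n$ all of whose edges have the same color. $\chi(q,n)$ is the minimum chromatic number of a $(q,n)$-path Ramsey ordered graph. $f(q,n)$ is the smallest $N$ such that every $q$-coloring of the edges of the complete digraph on $N$ vertices (two oppositely directed edges between any two distinct vertices) contains a monochromatic walk of length $n$, i.e., a sequence of $n$ vertices $v_1,\dots,v_n$ (repetitions allowed) such that all edges $\overrightarrow{v_iv_{i+1}}$ have the same color. -}

module Defs where

open import Data.Nat using (ℕ; suc; _≤_)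
open import Data.Fin using (Fin; toℕ; _<_)
open import Data.Bool using (Bool; true)
open import Data.Product using (Σ; ∃; _×_)
open import Relation.Binary.PropositionalEquality using (_≡_; _≢_)

IsMin : (ℕ → Set) → ℕ → Set
IsMin P m = P m × (∀ k → P k → m ≤ k)

Consec : {n : ℕ} → Fin n → Fin n → Set
Consec i j = toℕ j ≡ suc (toℕ i)

-- Ordered graphs: vertex set Fin N with its natural order.
-- adj i j (for i < j) says whether {i,j} is an edge.

record OrderedGraph : Set where
  field
    size : ℕ
    adj  : Fin size → Fin size → Bool
open OrderedGraph public

Edge : (G : OrderedGraph) → Fin (size G) → Fin (size G) → Set
Edge G i j = (i < j) × (adj G i j ≡ true)

-- q-edge-colouring: the edge {i,j}, i < j, gets colour c i j.
EdgeColouring : ℕ → OrderedGraph → Set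
EdgeColouring q G = Fin (size G) → Fin (size G) → Fin q

MonoMonotonePath : (q n : ℕ) (G : OrderedGraph) → EdgeColouring q G → Set
MonoMonotonePath q n G c =
  Σ (Fin n → Fin (size G)) λ v → Σ (Fin q) λ a →
    ∀ (i j : Fin n) → Consec i j → Edge G (v i) (v j) × (c (v i) (v j) ≡ a)

PathRamsey : (q n : ℕ) → OrderedGraph → Set
PathRamsey q n G = ∀ (c : EdgeColouring q G) → MonoMonotonePath q n G c

Colourable : OrderedGraph → ℕ → Set
Colourable G k = Σ (Fin (size G) → Fin k) λ col →
  ∀ (i j : Fin (size G)) → Edge G i j → col i ≢ col j

IsChromaticNumber : OrderedGraph → ℕ → Set
IsChromaticNumber G = IsMin (Colourable G)

IsChi : ℕ → ℕ → ℕ → Set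
IsChi q n = IsMin (λ k → Σ OrderedGraph λ G → PathRamsey q n G × IsChromaticNumber G k)

-- Complete digraph on Fin N: directed edge i → j for every i ≢ j,
-- q-coloured by c i j (values for i ≡ j are irrelevant).

DigraphColouring : ℕ → ℕ → Set
DigraphColouring q N = Fin N → Fin N → Fin q

-- Monochromatic walk with n vertices (repetitions allowed, but each step
-- uses an edge, i.e. consecutive vertices are distinct).
MonoWalk : (q n N : ℕ) → DigraphColouring q N → Set
MonoWalk q n N c =
  Σ (Fin n → Fin N) λ w → Σ (Fin q) λ a →
    ∀ (i j : Fin n) → Consec i j → (w i ≢ w j) × (c (w i) (w j) ≡ a)

WalkRamsey : ℕ → ℕ → ℕ → Set
WalkRamsey q n N = ∀ (c : DigraphColouring q N) → MonoWalk q n N c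

IsF : ℕ → ℕ → ℕ → Set
IsF q n = IsMin (WalkRamsey q n)

module Submission where

-- For a q-coloured relation E on Fin N with no monochromatic E-path on k+2
-- vertices, give every vertex v and colour a a height: the length (≤ k) of the
-- longest a-coloured E-path starting at v.  Along an edge x → y of colour a the
-- a-height strictly drops, so a vertex's height profile (one height per colour)
-- is a "potential" taking at most (k+1)^q values.
--
--  * f ≤ χ: a proper k-colouring of a (q,n)-path Ramsey graph turns every
--    colouring of the complete digraph on k vertices into a colouring of the
--    graph, and monotone paths become walks.
--  * χ ≤ f: blow each vertex of the complete digraph on F = f(q,n) vertices up
--    into a long column; the resulting ordered graph is F-colourable, and two
--    columns t < t' with the same height profiles carry an F-vertex digraph
--    colouring whose monochromatic walk would give a strictly descending
--    sequence of n heights below n-1.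
--  * f is attained: the walk property is decidable and holds for (n-1)^q + 1
--    vertices (pigeonhole on height profiles), so a least witness exists.

open import Defs
open import Data.Nat using (ℕ; _≤_)
open import Data.Product using (Σ; _×_)

open import Data.Nat using (zero; suc; _*_; _^_; _<_; z≤n; s≤s; _≟_)
import Data.Nat.Properties as ℕ
open import Data.Fin using (Fin; zero; suc; toℕ; fromℕ<; combine; remainder; funToFin; finToFun)
import Data.Fin as Fin
import Data.Fin.Properties as Fin
open import Data.Vec.Functional using (_∷_)
open import Data.Bool using (true)
import Data.Bool as Bool
open import Data.Product using (_,_; proj₁; proj₂; ∃)
open import Data.Sum using (_⊎_; inj₁; inj₂)
open import Data.Empty using (⊥)
open import Function using (_∘_)
open import Relation.Nullary using (Dec; yes; no; ¬_; does; contradiction)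
open import Relation.Nullary.Decidable using (decidable-stable; _×-dec_; _→-dec_; ¬?; dec-true)
open import Relation.Binary.PropositionalEquality
  using (_≡_; _≢_; _≗_; refl; sym; trans; cong; subst; subst₂)

least-below : (P : ℕ → Set) → (∀ m → Dec (P m)) →
  ∀ b → Σ ℕ (IsMin P) ⊎ (∀ m → m < b → ¬ P m)
least-below P P? zero = inj₂ (λ m ())
least-below P P? (suc b) with least-below P P? b
... | inj₁ found = inj₁ found
... | inj₂ none with P? b
...   | yes pb = inj₁ (b , pb , λ m pm → ℕ.≮⇒≥ (λ m<b → none m m<b pm))
...   | no ¬pb = inj₂ none′
  where
  none′ : ∀ m → m < suc b → ¬ P m
  none′ m m<1+b with ℕ.m≤n⇒m<n∨m≡n (ℕ.≤-pred m<1+b)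
  ... | inj₁ m<b = none m m<b
  ... | inj₂ refl = ¬pb

least : (P : ℕ → Set) → (∀ m → Dec (P m)) → ∀ N → P N → Σ ℕ (IsMin P)
least P P? N pN with least-below P P? (suc N)
... | inj₁ found = found
... | inj₂ none  = contradiction pN (none N (ℕ.n<1+n N))

IsMaxBelow : ℕ → (ℕ → Set) → ℕ → Set
IsMaxBelow k P m = m ≤ k × P m × (∀ j → j ≤ k → P j → j ≤ m)

greatest : (P : ℕ → Set) → (∀ m → Dec (P m)) → P 0 → ∀ k → Σ ℕ (IsMaxBelow k P)
greatest P P? p0 zero = 0 , z≤n , p0 , λ j j≤0 _ → j≤0
greatest P P? p0 (suc k) with P? (suc k)
... | yes pk = suc k , ℕ.≤-refl , pk , λ j j≤k _ → j≤k
... | no ¬pk with greatest P P? p0 k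
...   | m , m≤k , pm , max = m , ℕ.m≤n⇒m≤1+n m≤k , pm , max′
  where
  max′ : ∀ j → j ≤ suc k → P j → j ≤ m
  max′ j j≤1+k pj with ℕ.m≤n⇒m<n∨m≡n j≤1+k
  ... | inj₁ j<1+k = max j (ℕ.≤-pred j<1+k) pj
  ... | inj₂ refl = contradiction pj ¬pk

descending-start : ∀ k (g : Fin (suc k) → ℕ) →
  (∀ i j → Consec i j → g j < g i) → k ≤ g zero
descending-start zero    g desc = z≤n
descending-start (suc k) g desc =
  ℕ.≤-<-trans (descending-start k (g ∘ suc) (λ i j c → desc (suc i) (suc j) (cong suc c)))
              (desc zero (suc zero) refl)

funToFin-injective : ∀ {k b} (f g : Fin k → Fin b) → funToFin f ≡ funToFin g → f ≗ g
funToFin-injective f g eq i =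
  trans (sym (Fin.finToFun-funToFin f i))
        (trans (cong (λ z → finToFun z i) eq) (Fin.finToFun-funToFin g i))

module FunctionSpace {k b : ℕ} (P : (Fin k → Fin b) → Set)
       (resp : ∀ {f g} → f ≗ g → P f → P g) (P? : ∀ f → Dec (P f)) where

  ∃? : Dec (∃ P)
  ∃? with Fin.any? (λ i → P? (finToFun i))
  ... | yes (i , p) = yes (finToFun i , p)
  ... | no ¬p = no λ { (f , pf) →
          ¬p (funToFin f , resp (λ i → sym (Fin.finToFun-funToFin f i)) pf) }

  ∀? : Dec (∀ f → P f)
  ∀? with Fin.all? (λ i → P? (finToFun i))
  ... | yes all = yes λ f → resp (Fin.finToFun-funToFin f) (all (funToFin f))
  ... | no ¬all = no λ all → ¬all (λ i → all (finToFun i))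

module MonochromaticPaths {N q : ℕ} (E : Fin N → Fin N → Set)
       (E? : ∀ x y → Dec (E x y)) (col : Fin N → Fin N → Fin q) where

  Mono : ∀ {m} → Fin q → (Fin m → Fin N) → Set
  Mono a p = ∀ i j → Consec i j → E (p i) (p j) × (col (p i) (p j) ≡ a)

  -- A monochromatic path on m vertices (MonoWalk and MonoMonotonePath unfold to this).
  MonoPath : ℕ → Set
  MonoPath m = Σ (Fin m → Fin N) λ p → Σ (Fin q) λ a → Mono a p

  Mono-resp : ∀ {m a} {p p′ : Fin m → Fin N} → p ≗ p′ → Mono a p → Mono a p′
  Mono-resp {a = a} eq mono i j c =
    subst₂ (λ u v → E u v × (col u v ≡ a)) (eq i) (eq j) (mono i j c)

  Mono? : ∀ {m} a (p : Fin m → Fin N) → Dec (Mono a p)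
  Mono? a p = Fin.all? λ i → Fin.all? λ j →
    (toℕ j ≟ suc (toℕ i)) →-dec (E? (p i) (p j) ×-dec (col (p i) (p j) Fin.≟ a))

  MonoPath? : ∀ m → Dec (MonoPath m)
  MonoPath? m = FunctionSpace.∃? (λ p → Σ (Fin q) λ a → Mono a p)
    (λ { eq (a , mono) → a , Mono-resp eq mono })
    (λ p → Fin.any? λ a → Mono? a p)

  PathFrom : Fin q → ℕ → Fin N → Set
  PathFrom a m v = Σ (Fin (suc m) → Fin N) λ p → (p zero ≡ v) × Mono a p

  PathFrom? : ∀ a m v → Dec (PathFrom a m v)
  PathFrom? a m v = FunctionSpace.∃? (λ p → (p zero ≡ v) × Mono a p)
    (λ { eq (p₀ , mono) → trans (sym (eq zero)) p₀ , Mono-resp eq mono })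
    (λ p → (p zero Fin.≟ v) ×-dec Mono? a p)

  extend : ∀ {x y m} → E x y → PathFrom (col x y) m y → PathFrom (col x y) (suc m) x
  extend {x} {y} e (p , refl , mono) = (x ∷ p) , refl , mono′
    where
    mono′ : Mono (col x y) (x ∷ p)
    mono′ zero    (suc zero)    _ = e , refl
    mono′ (suc i) (suc j)       c = mono i j (ℕ.suc-injective c)
    mono′ zero    zero          ()
    mono′ zero    (suc (suc j)) ()
    mono′ (suc i) zero          ()

  trivial-path : ∀ a v → PathFrom a 0 v
  trivial-path a v = (λ _ → v) , refl , λ { zero zero () }

  module Heights (k : ℕ) where

    height-spec : ∀ a v → Σ ℕ (IsMaxBelow k (λ m → PathFrom a m v))
    height-spec a v = greatest _ (λ m → PathFrom? a m v) (trivial-path a v) k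

    height : Fin q → Fin N → ℕ
    height a v = proj₁ (height-spec a v)

    height≤ : ∀ a v → height a v ≤ k
    height≤ a v = proj₁ (proj₂ (height-spec a v))

    height-decreases : ¬ MonoPath (suc (suc k)) →
      ∀ {x y} → E x y → height (col x y) y < height (col x y) x
    height-decreases noPath {x} {y} e
      with height-spec (col x y) y | height-spec (col x y) x
    ... | m , m≤k , path , _ | _ , _ , _ , max with ℕ.m≤n⇒m<n∨m≡n m≤k
    ...   | inj₁ m<k = max (suc m) m<k (extend e path)
    ...   | inj₂ refl with extend e path
    ...     | p , _ , mono = contradiction (p , col x y , mono) noPath

    profile : Fin N → Fin (suc k ^ q)
    profile v = funToFin λ a → fromℕ< (s≤s (height≤ a v))

    profile-heights : ∀ {x y} → profile x ≡ profile y → ∀ a → height a x ≡ height a y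
    profile-heights {x} {y} eq a =
      trans (sym (Fin.toℕ-fromℕ< (s≤s (height≤ a x))))
            (trans (cong toℕ (funToFin-injective _ _ eq a))
                   (Fin.toℕ-fromℕ< (s≤s (height≤ a y))))

module Digraph {q N : ℕ} (c : DigraphColouring q N) =
  MonochromaticPaths {N} {q} _≢_ (λ x y → ¬? (x Fin.≟ y)) c

MonoWalk-resp : ∀ {q n N} {c c′ : DigraphColouring q N} →
  (∀ x y → c x y ≡ c′ x y) → MonoWalk q n N c → MonoWalk q n N c′
MonoWalk-resp eq (w , a , mono) =
  w , a , λ i j s → proj₁ (mono i j s) , trans (sym (eq (w i) (w j))) (proj₂ (mono i j s))

-- Whether N vertices force a monochromatic walk is decidable: a colouring
-- is determined by its rows, each an element of Fin (q ^ N).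
walkRamsey? : ∀ q n N → Dec (WalkRamsey q n N)
walkRamsey? q n N with FunctionSpace.∀? {N} {q ^ N}
    (λ c → MonoWalk q n N (λ x → finToFun (c x)))
    (λ eq → MonoWalk-resp (λ x y → cong (λ z → finToFun z y) (eq x)))
    (λ c → Digraph.MonoPath? (λ x → finToFun (c x)) n)
... | yes all = yes λ c →
        MonoWalk-resp (λ x → Fin.finToFun-funToFin (c x)) (all (λ x → funToFin (c x)))
... | no ¬all = no λ wr → ¬all (λ c → wr (λ x → finToFun (c x)))

-- f(q,k+2) ≤ (k+1)^q + 1: two vertices with equal height profiles cannot
-- be joined by an edge.
walkRamsey-bound : ∀ q k → WalkRamsey q (suc (suc k)) (suc (suc k ^ q))
walkRamsey-bound q k c = decidable-stable (MonoPath? (suc (suc k))) λ noWalk →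
  let x , y , x<y , same = Fin.pigeonhole (ℕ.n<1+n (suc k ^ q)) profile
  in ℕ.<⇒≢ (height-decreases noWalk (Fin.<⇒≢ x<y)) (sym (profile-heights same (c x y)))
  where
  open Digraph c
  open Heights k

-- f ≤ χ: pull a digraph colouring back along a proper vertex colouring; a
-- monochromatic monotone path maps to a monochromatic walk.
walkRamsey-from-colouring : ∀ {q n G k} →
  PathRamsey q n G → Colourable G k → WalkRamsey q n k
walkRamsey-from-colouring pathRamsey (vcol , proper) c
  with pathRamsey (λ x y → c (vcol x) (vcol y))
... | v , a , mono = (λ i → vcol (v i)) , a ,
        λ i j s → proper (v i) (v j) (proj₁ (mono i j s)) , proj₂ (mono i j s)

-- For χ ≤ f we blow up F classes into columns; there is one column more
-- than there are possible column height profiles.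
columns : ℕ → ℕ → ℕ → ℕ
columns q k F = suc ((suc k ^ q) ^ F)

class : ∀ q k F → Fin (columns q k F * F) → Fin F
class q k F = remainder {columns q k F} F

class-combine : ∀ q k F (t : Fin (columns q k F)) i → class q k F (combine t i) ≡ i
class-combine q k F t i = cong proj₂ (Fin.remQuot-combine t i)

blowup : ℕ → ℕ → ℕ → OrderedGraph
blowup q k F = record
  { size = columns q k F * F
  ; adj  = λ x y → does (¬? (class q k F x Fin.≟ class q k F y))
  }

decided-true : ∀ {A : Set} (d : Dec A) → does d ≡ true → A
decided-true (yes a) _  = a
decided-true (no _)  ()

blowup-colourable : ∀ q k F → Colourable (blowup q k F) F
blowup-colourable q k F = class q k F ,
  λ x y e → decided-true (¬? (class q k F x Fin.≟ class q k F y)) (proj₂ e)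

blowup-edge : ∀ q k F {t t′ : Fin (columns q k F)} {i j : Fin F} →
  t Fin.< t′ → i ≢ j → Edge (blowup q k F) (combine t i) (combine t′ j)
blowup-edge q k F {t} {t′} {i} {j} t<t′ i≢j =
  Fin.combine-monoˡ-< i j t<t′ ,
  dec-true (¬? (class q k F (combine t i) Fin.≟ class q k F (combine t′ j)))
           (λ eq → i≢j (trans (sym (class-combine q k F t i))
                              (trans eq (class-combine q k F t′ j))))

Edge? : ∀ G (x y : Fin (size G)) → Dec (Edge G x y)
Edge? G x y = (x Fin.<? y) ×-dec (adj G x y Bool.≟ true)

module BlowupColouring (q k F : ℕ) (walkRamsey : WalkRamsey q (suc (suc k)) F)
       (c : EdgeColouring q (blowup q k F)) where

  open MonochromaticPaths (Edge (blowup q k F)) (Edge? (blowup q k F)) c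
  open Heights k

  columnProfile : Fin (columns q k F) → Fin ((suc k ^ q) ^ F)
  columnProfile t = funToFin λ i → profile (combine t i)

  -- Two columns with equal profiles give, via the walk property, a descending
  -- sequence of k+2 heights that are all ≤ k.
  equal-columns-impossible : ¬ MonoPath (suc (suc k)) → ∀ {t t′} → t Fin.< t′ →
    columnProfile t ≡ columnProfile t′ → ⊥
  equal-columns-impossible noPath {t} {t′} t<t′ same =
    ℕ.<⇒≱ (s≤s (height≤ a (combine t (w zero)))) (descending-start (suc k) g descending)
    where
    column-heights : ∀ i a → height a (combine t′ i) ≡ height a (combine t i)
    column-heights i a = sym (profile-heights (funToFin-injective _ _ same i) a)
    walk : MonoWalk q (suc (suc k)) F (λ i j → c (combine t i) (combine t′ j))
    walk = walkRamsey (λ i j → c (combine t i) (combine t′ j))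
    w : Fin (suc (suc k)) → Fin F
    w = proj₁ walk
    a : Fin q
    a = proj₁ (proj₂ walk)
    g : Fin (suc (suc k)) → ℕ
    g s = height a (combine t (w s))
    descending : ∀ s s′ → Consec s s′ → g s′ < g s
    descending s s′ cs with proj₂ (proj₂ walk) s s′ cs
    ... | ws≢ws′ , colour = subst (_< g s) (column-heights (w s′) a)
        (subst (λ b → height b (combine t′ (w s′)) < height b (combine t (w s))) colour
          (height-decreases noPath (blowup-edge q k F t<t′ ws≢ws′)))

  monoPath : MonoPath (suc (suc k))
  monoPath = decidable-stable (MonoPath? (suc (suc k))) λ noPath →
    let t , t′ , t<t′ , same = Fin.pigeonhole (ℕ.n<1+n _) columnProfile
    in equal-columns-impossible noPath t<t′ same

blowup-pathRamsey : ∀ q k F → WalkRamsey q (suc (suc k)) F →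
  PathRamsey q (suc (suc k)) (blowup q k F)
blowup-pathRamsey q k F walkRamsey c = BlowupColouring.monoPath q k F walkRamsey c

-- If f(q,k+2) = m then χ(q,k+2) = m: the blow-up on m classes is path Ramsey
-- with chromatic number m, and any path Ramsey graph with a proper j-colouring
-- has m ≤ j (f ≤ χ).
IsF⇒IsChi : ∀ q k m → IsF q (suc (suc k)) m → IsChi q (suc (suc k)) m
IsF⇒IsChi q k m (walkRamsey , minimal) =
  (blowup q k m , pathRamsey , blowup-colourable q k m , λ j colourable →
     minimal j (walkRamsey-from-colouring pathRamsey colourable)) ,
  λ { j (G , pathRamsey′ , colourable , _) →
        minimal j (walkRamsey-from-colouring pathRamsey′ colourable) }
  where
  pathRamsey : PathRamsey q (suc (suc k)) (blowup q k m)
  pathRamsey = blowup-pathRamsey q k m walkRamsey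

-- f(q,n) exists (the walk property is decidable and eventually true), and
-- χ(q,n) equals it.
theorem9 : (q n : ℕ) → 2 ≤ q → 2 ≤ n →
    Σ ℕ (λ m → IsChi q n m × IsF q n m)
theorem9 q (suc zero)    _ (s≤s ())
theorem9 q (suc (suc k)) _ _ =
  let m , isF = least (WalkRamsey q (suc (suc k))) (walkRamsey? q (suc (suc k)))
                      _ (walkRamsey-bound q k)
  in m , IsF⇒IsChi q k m isF , isF
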